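{- Let $k\ge 4$ be even, $1\le s\le k-1$, $m$ a positive integer, $n=m(k-s)\ge 2k-s$, and let $G$ be the $k$-uniform $s$-cycle with vertex set $[n]$ (labels modulo $n$) and edges $\{1+j(k-s),\dots,s+(j+1)(k-s)\}$, $j=0,\dots,m-1$. If $G$ is not regular, then $G$ is odd-bipartite.
   Context: A hypergraph is regular if all vertices have the same degree (number of edges containing the vertex). A $k$-uniform hypergraph $G=(V,E)$ with $k$ even is odd-bipartite if either $E=\emptyset$ or there is a partition $V=V_1\cup V_2$ with $V_1,V_2\ne\emptyset$ such that every edge meets $V_1$ in an odd number of vertices. -}

module Defs where

open import Data.Nat using (ℕ; zero; suc; _+_; _*_; _∸_; _%_)
open import Data.Nat.Properties using (_≟_)
open import Data.Fin using (Fin; toℕ)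
open import Data.Fin.Subset using (Subset; _∈_; _∩_; ∣_∣; ∁; Nonempty)
open import Data.Fin.Subset.Properties using (_∈?_)
open import Data.List using (List; length; filter; upTo)
open import Data.Bool.ListAction using (any)
open import Data.Sum using (_⊎_)
open import Data.List.Base using (allFin)
open import Data.Vec using (tabulate)
open import Data.Product using (Σ; _×_)
open import Relation.Nullary.Decidable using (⌊_⌋)
open import Relation.Binary.PropositionalEquality using (_≡_)

-- A hypergraph on vertex set Fin n, with its edges listed (without
-- repetition in our application) as a family indexed by Fin m.
record Hypergraph : Set where
  field
    nV    : ℕ
    nE    : ℕ
    edge  : Fin nE → Subset nV
open Hypergraph public

degree : (G : Hypergraph) → Fin (nV G) → ℕ
degree G v = length (filter (λ j → v ∈? edge G j) (allFin (nE G)))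

Regular : Hypergraph → Set
Regular G = ∀ u v → degree G u ≡ degree G v

Odd : ℕ → Set
Odd a = a % 2 ≡ 1

OddBipartite : Hypergraph → Set
OddBipartite G =
  (nE G ≡ 0) ⊎ Σ (Subset (nV G)) λ V₁ →
     Nonempty V₁ × Nonempty (∁ V₁) × (∀ j → Odd ∣ edge G j ∩ V₁ ∣)

-- Vertices labelled 0..n-1 (label ℓ here corresponds to ℓ+1 in the paper).
-- Edge j = { j(k-s) + i  mod n  |  0 ≤ i < k }, i.e. paper's
-- {1+j(k-s), …, s+(j+1)(k-s)} shifted by one.
cycleEdge : (k s n : ℕ) → ℕ → Subset n
cycleEdge k s zero    j = tabulate λ ()
cycleEdge k s (suc n) j =
  tabulate λ v → any (λ i → ⌊ (j * (k ∸ s) + i) % suc n ≟ toℕ v ⌋) (upTo k)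

sCycle : (k s m : ℕ) → Hypergraph
sCycle k s m = record
  { nV = m * (k ∸ s)
  ; nE = m
  ; edge = λ j → cycleEdge k s (m * (k ∸ s)) (toℕ j)
  }

module Submission where

-- Write D = k - s (the step between consecutive edges) and
-- n = m·D.  Edge j is the cyclic window of k consecutive vertices starting at
-- j·D, so a vertex v lies in it iff its forward distance (n - j·D + v) mod n
-- from j·D is below k.  Divide k = q·D + r with 0 ≤ r < D.
--   * If r = 0, every vertex v = a·D + b lies in exactly q edges: as j runs
--     over Fin m the distances run through (c mod m)·D + b for all residues
--     c mod m, and exactly q of these are below q·D.  So G is regular.
--   * If r ≠ 0, let V₁ be the residue class {v : v ≡ t mod D}.  Since D
--     divides both n and every starting point j·D, each edge meets V₁ in
--     #{y < k : y ≡ t mod D} = q + [t < r] vertices; taking t = 0 when q is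
--     even and t = r when q is odd makes this odd for every edge.

open import Defs
open import Data.Nat
open import Data.Nat.Properties
open import Data.Nat.DivMod
open import Data.Nat.Divisibility using (_∣_; divides; n∣m*n; m%n≡0⇒n∣m)
open import Data.Nat.Tactic.RingSolver using (solve-∀)
open import Data.Bool using (Bool; true; false; _∧_; not; T)
open import Data.Bool.Properties using (∧-identityʳ)
open import Data.Bool.ListAction using (any)
open import Data.Fin using (Fin; toℕ; fromℕ<) renaming (zero to fzero; suc to fsuc)
open import Data.Fin.Properties using (toℕ<n; toℕ-fromℕ<)
open import Data.Fin.Subset using (Subset; _∈_; _∩_; ∣_∣; ∁; Nonempty; inside; outside)
open import Data.Fin.Subset.Properties using (_∈?_)
open import Data.Vec using ([]; _∷_; lookup; tabulate)
open import Data.Vec.Properties using (lookup∘tabulate; lookup-zipWith; lookup-map; lookup⇒[]=)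
open import Data.List using (length; filter; upTo)
import Data.List as List
open import Data.List.Membership.Propositional using (find; lose)
open import Data.List.Membership.Propositional.Properties using (∈-upTo⁺; ∈-upTo⁻)
open import Data.List.Relation.Unary.Any.Properties using (any⁺; any⁻)
open import Data.Product using (Σ; _×_; _,_; proj₁; proj₂)
open import Data.Sum using (inj₂)
open import Data.Empty using (⊥-elim)
open import Function using (_⇔_; mk⇔)
open import Relation.Nullary using (¬_; Dec; yes; no; does)
open import Relation.Nullary.Decidable
  using (⌊_⌋; T?; isYes≗does; dec-true; dec-false; does-⇔; toWitness; fromWitness)
open import Relation.Binary.PropositionalEquality

private
  variable
    A B : Set

bit : Bool → ℕ
bit true  = 1
bit false = 0

⌊⌋-true : (a? : Dec A) → A → ⌊ a? ⌋ ≡ true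
⌊⌋-true a? a = trans (isYes≗does a?) (dec-true a? a)

⌊⌋-false : (a? : Dec A) → ¬ A → ⌊ a? ⌋ ≡ false
⌊⌋-false a? ¬a = trans (isYes≗does a?) (dec-false a? ¬a)

T⇔-⌊⌋ : ∀ {b} (a? : Dec A) → T b ⇔ A → b ≡ ⌊ a? ⌋
T⇔-⌊⌋ {b = b} a? b⇔a = trans (does-⇔ b⇔a (T? b) a?) (sym (isYes≗does a?))

⌊⌋-⇔ : (a? : Dec A) (b? : Dec B) → A ⇔ B → ⌊ a? ⌋ ≡ ⌊ b? ⌋
⌊⌋-⇔ a? b? a⇔b =
  trans (isYes≗does a?) (trans (does-⇔ a⇔b a? b?) (sym (isYes≗does b?)))

count : (ℕ → Bool) → ℕ → ℕ
count f zero    = 0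
count f (suc n) = bit (f 0) + count (λ x → f (suc x)) n

count-cong : ∀ n {f g : ℕ → Bool} → (∀ x → x < n → f x ≡ g x) → count f n ≡ count g n
count-cong zero    f≗g = refl
count-cong (suc n) f≗g =
  cong₂ _+_ (cong bit (f≗g 0 z<s)) (count-cong n (λ x x<n → f≗g (suc x) (s<s x<n)))

count-+ : ∀ a b (f : ℕ → Bool) → count f (a + b) ≡ count f a + count (λ x → f (a + x)) b
count-+ zero    b f = refl
count-+ (suc a) b f =
  trans (cong (bit (f 0) +_) (count-+ a b (λ x → f (suc x)))) (sym (+-assoc (bit (f 0)) _ _))

count-snoc : ∀ n (f : ℕ → Bool) → count f (suc n) ≡ count f n + bit (f n)
count-snoc zero    f = +-comm (bit (f 0)) 0
count-snoc (suc n) f =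
  trans (cong (bit (f 0) +_) (count-snoc n (λ x → f (suc x)))) (sym (+-assoc (bit (f 0)) _ _))

count-false : ∀ n {f : ℕ → Bool} → (∀ x → x < n → f x ≡ false) → count f n ≡ 0
count-false zero    _    = refl
count-false (suc n) f≡ff rewrite f≡ff 0 z<s = count-false n (λ x x<n → f≡ff (suc x) (s<s x<n))

count-true : ∀ n {f : ℕ → Bool} → (∀ x → x < n → f x ≡ true) → count f n ≡ n
count-true zero    _    = refl
count-true (suc n) f≡tt rewrite f≡tt 0 z<s = cong suc (count-true n (λ x x<n → f≡tt (suc x) (s<s x<n)))

count-prefix : ∀ {k n} (f : ℕ → Bool) → k ≤ n → count (λ y → ⌊ y <? k ⌋ ∧ f y) n ≡ count f k
count-prefix {k} {n} f k≤n = begin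
  count g n                                       ≡⟨ cong (count g) (sym (m+[n∸m]≡n k≤n)) ⟩
  count g (k + (n ∸ k))                           ≡⟨ count-+ k (n ∸ k) g ⟩
  count g k + count (λ y → g (k + y)) (n ∸ k)     ≡⟨ cong₂ _+_ (count-cong k inside-k)
                                                      (count-false (n ∸ k) outside-k) ⟩
  count f k + 0                                   ≡⟨ +-identityʳ _ ⟩
  count f k                                       ∎
  where
  open ≡-Reasoning
  g : ℕ → Bool
  g y = ⌊ y <? k ⌋ ∧ f y
  inside-k : ∀ y → y < k → g y ≡ f y
  inside-k y y<k = cong (_∧ f y) (⌊⌋-true (y <? k) y<k)
  outside-k : ∀ y → y < n ∸ k → g (k + y) ≡ false
  outside-k y _ = cong (_∧ f (k + y)) (⌊⌋-false (k + y <? k) (m+n≮m k y))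

count-below : ∀ {q m} → q ≤ m → count (λ y → ⌊ y <? q ⌋) m ≡ q
count-below {q} {m} q≤m = begin
  count (λ y → ⌊ y <? q ⌋) m          ≡⟨ count-cong m (λ y _ → sym (∧-identityʳ _)) ⟩
  count (λ y → ⌊ y <? q ⌋ ∧ true) m   ≡⟨ count-prefix (λ _ → true) q≤m ⟩
  count (λ _ → true) q                ≡⟨ count-true q (λ _ _ → refl) ⟩
  q                                   ∎
  where open ≡-Reasoning

count-rotate : ∀ n c (f : ℕ → Bool) .{{_ : NonZero n}} → c ≤ n →
               count (λ x → f ((c + x) % n)) n ≡ count f n
count-rotate n c f c≤n = begin
  count g n                                         ≡⟨ cong (count g) (sym (m∸n+n≡m c≤n)) ⟩
  count g (n ∸ c + c)                               ≡⟨ count-+ (n ∸ c) c g ⟩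
  count g (n ∸ c) + count (λ y → g (n ∸ c + y)) c   ≡⟨ cong₂ _+_ (count-cong (n ∸ c) no-wrap)
                                                        (count-cong c wrap) ⟩
  count (λ x → f (c + x)) (n ∸ c) + count f c       ≡⟨ +-comm _ (count f c) ⟩
  count f c + count (λ x → f (c + x)) (n ∸ c)       ≡⟨ sym (count-+ c (n ∸ c) f) ⟩
  count f (c + (n ∸ c))                             ≡⟨ cong (count f) (m+[n∸m]≡n c≤n) ⟩
  count f n                                         ∎
  where
  open ≡-Reasoning
  g : ℕ → Bool
  g x = f ((c + x) % n)
  no-wrap : ∀ x → x < n ∸ c → g x ≡ f (c + x)
  no-wrap x x<n∸c = cong f (m<n⇒m%n≡m (subst (c + x <_) (m+[n∸m]≡n c≤n) (+-monoʳ-< c x<n∸c)))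
  wrap : ∀ y → y < c → g (n ∸ c + y) ≡ f y
  wrap y y<c = cong f (begin
    (c + (n ∸ c + y)) % n   ≡⟨ cong (_% n) (trans (sym (+-assoc c (n ∸ c) y))
                                                  (cong (_+ y) (m+[n∸m]≡n c≤n))) ⟩
    (n + y) % n             ≡⟨ cong (_% n) (+-comm n y) ⟩
    (y + n) % n             ≡⟨ [m+n]%n≡m%n y n ⟩
    y % n                   ≡⟨ m<n⇒m%n≡m (<-≤-trans y<c c≤n) ⟩
    y                       ∎)

count-reverse : ∀ n (f : ℕ → Bool) → count (λ x → f (n ∸ suc x)) n ≡ count f n
count-reverse zero    f = refl
count-reverse (suc n) f = begin
  bit (f n) + count (λ x → f (n ∸ suc x)) n  ≡⟨ cong (bit (f n) +_) (count-reverse n f) ⟩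
  bit (f n) + count f n                      ≡⟨ +-comm (bit (f n)) _ ⟩
  count f n + bit (f n)                      ≡⟨ sym (count-snoc n f) ⟩
  count f (suc n)                            ∎
  where open ≡-Reasoning

count-point : ∀ r t → count (λ y → ⌊ y ≟ t ⌋) r ≡ bit ⌊ t <? r ⌋
count-point zero    t       = refl
count-point (suc r) zero    = cong suc (count-false r (λ _ _ → refl))
count-point (suc r) (suc t) = begin
  count (λ y → ⌊ suc y ≟ suc t ⌋) r  ≡⟨ count-cong r (λ y _ → ⌊⌋-⇔ (suc y ≟ suc t) (y ≟ t)
                                           (mk⇔ suc-injective (cong suc))) ⟩
  count (λ y → ⌊ y ≟ t ⌋) r          ≡⟨ count-point r t ⟩
  bit ⌊ t <? r ⌋                     ≡⟨ cong bit (⌊⌋-⇔ (t <? r) (suc t <? suc r) (mk⇔ s<s s<s⁻¹)) ⟩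
  bit ⌊ suc t <? suc r ⌋             ∎
  where open ≡-Reasoning

count-residue : ∀ D .{{_ : NonZero D}} t q r → t < D → r ≤ D →
                count (λ y → ⌊ y % D ≟ t ⌋) (q * D + r) ≡ q + bit ⌊ t <? r ⌋
count-residue D t zero r t<D r≤D =
  trans (count-cong r (λ y y<r → cong (λ z → ⌊ z ≟ t ⌋) (m<n⇒m%n≡m (<-≤-trans y<r r≤D))))
        (count-point r t)
count-residue D t (suc q) r t<D r≤D = begin
  count h (D + q * D + r)                        ≡⟨ cong (count h) (+-assoc D (q * D) r) ⟩
  count h (D + (q * D + r))                      ≡⟨ count-+ D (q * D + r) h ⟩
  count h D + count (λ y → h (D + y)) (q * D + r)
    ≡⟨ cong₂ _+_ (count-residue D t zero D t<D ≤-refl)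
                 (trans (count-cong (q * D + r) (λ y _ → cong (λ z → ⌊ z ≟ t ⌋) (shift y)))
                        (count-residue D t q r t<D r≤D)) ⟩
  bit ⌊ t <? D ⌋ + (q + bit ⌊ t <? r ⌋)          ≡⟨ cong (λ b → bit b + _) (⌊⌋-true (t <? D) t<D) ⟩
  suc (q + bit ⌊ t <? r ⌋)                       ∎
  where
  open ≡-Reasoning
  h : ℕ → Bool
  h y = ⌊ y % D ≟ t ⌋
  shift : ∀ y → (D + y) % D ≡ y % D
  shift y = trans (cong (_% D) (+-comm D y)) ([m+n]%n≡m%n y D)

%-absorbʳ-+ : ∀ a b n .{{_ : NonZero n}} → (a + b % n) % n ≡ (a + b) % n
%-absorbʳ-+ a b n = begin
  (a + b % n) % n            ≡⟨ %-distribˡ-+ a (b % n) n ⟩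
  (a % n + b % n % n) % n    ≡⟨ cong (λ z → (a % n + z) % n) (m%n%n≡m%n b n) ⟩
  (a % n + b % n) % n        ≡⟨ sym (%-distribˡ-+ a b n) ⟩
  (a + b) % n                ∎
  where open ≡-Reasoning

distance-to-shift : ∀ {n} .{{_ : NonZero n}} {e} i → e ≤ n → (n ∸ e + (e + i) % n) % n ≡ i % n
distance-to-shift {n} {e} i e≤n = begin
  (n ∸ e + (e + i) % n) % n   ≡⟨ %-absorbʳ-+ (n ∸ e) (e + i) n ⟩
  (n ∸ e + (e + i)) % n       ≡⟨ cong (_% n) (sym (+-assoc (n ∸ e) e i)) ⟩
  (n ∸ e + e + i) % n         ≡⟨ cong (λ z → (z + i) % n) (m∸n+n≡m e≤n) ⟩
  (n + i) % n                 ≡⟨ cong (_% n) (+-comm n i) ⟩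
  (i + n) % n                 ≡⟨ [m+n]%n≡m%n i n ⟩
  i % n                       ∎
  where open ≡-Reasoning

shift-by-distance : ∀ {n} .{{_ : NonZero n}} {e v} → e ≤ n → v < n → (e + (n ∸ e + v) % n) % n ≡ v
shift-by-distance {n} {e} {v} e≤n v<n = begin
  (e + (n ∸ e + v) % n) % n   ≡⟨ %-absorbʳ-+ e (n ∸ e + v) n ⟩
  (e + (n ∸ e + v)) % n       ≡⟨ cong (_% n) (sym (+-assoc e (n ∸ e) v)) ⟩
  (e + (n ∸ e) + v) % n       ≡⟨ cong (λ z → (z + v) % n) (m+[n∸m]≡n e≤n) ⟩
  (n + v) % n                 ≡⟨ cong (_% n) (+-comm n v) ⟩
  (v + n) % n                 ≡⟨ [m+n]%n≡m%n v n ⟩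
  v % n                       ≡⟨ m<n⇒m%n≡m v<n ⟩
  v                           ∎
  where open ≡-Reasoning

window-member : ∀ {n} .{{_ : NonZero n}} k e v → e ≤ n → v < n →
                any (λ i → ⌊ (e + i) % n ≟ v ⌋) (upTo k) ≡ ⌊ (n ∸ e + v) % n <? k ⌋
window-member {n} k e v e≤n v<n = T⇔-⌊⌋ ((n ∸ e + v) % n <? k) (mk⇔ hit⇒near near⇒hit)
  where
  hits : ℕ → Bool
  hits i = ⌊ (e + i) % n ≟ v ⌋
  hit⇒near : T (any hits (upTo k)) → (n ∸ e + v) % n < k
  hit⇒near h with (i , i∈upTo , hit) ← find (any⁻ hits (upTo k) h) =
    subst (λ w → (n ∸ e + w) % n < k) (toWitness hit)
      (subst (_< k) (sym (distance-to-shift i e≤n)) (≤-<-trans (m%n≤m i n) (∈-upTo⁻ i∈upTo)))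
  near⇒hit : (n ∸ e + v) % n < k → T (any hits (upTo k))
  near⇒hit d<k = any⁺ hits (lose (∈-upTo⁺ d<k) (fromWitness (shift-by-distance e≤n v<n)))

∣∣-count : ∀ {n} (p : Subset n) (g : ℕ → Bool) →
           (∀ v → lookup p v ≡ g (toℕ v)) → ∣ p ∣ ≡ count g n
∣∣-count []      g p≗g = refl
∣∣-count (inside  ∷ p) g p≗g rewrite sym (p≗g fzero) = cong suc (∣∣-count p _ (λ v → p≗g (fsuc v)))
∣∣-count (outside ∷ p) g p≗g rewrite sym (p≗g fzero) = ∣∣-count p _ (λ v → p≗g (fsuc v))

filter-count : ∀ m (h : Fin m → A) {P : A → Set} (P? : ∀ x → Dec (P x)) (g : ℕ → Bool) →
               (∀ j → does (P? (h j)) ≡ g (toℕ j)) →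
               length (filter P? (List.tabulate h)) ≡ count g m
filter-count zero    h P? g h≗g = refl
filter-count (suc m) h P? g h≗g with does (P? (h fzero)) | h≗g fzero
... | false | ff≡g0 rewrite sym ff≡g0 = filter-count m (λ j → h (fsuc j)) P? _ (λ j → h≗g (fsuc j))
... | true  | tt≡g0 rewrite sym tt≡g0 =
  cong suc (filter-count m (λ j → h (fsuc j)) P? _ (λ j → h≗g (fsuc j)))

∈?-does : ∀ {n} (v : Fin n) (p : Subset n) → does (v ∈? p) ≡ lookup p v
∈?-does fzero    (inside  ∷ p) = refl
∈?-does fzero    (outside ∷ p) = refl
∈?-does (fsuc v) (x ∷ p)       = ∈?-does v p

degree-count : (G : Hypergraph) (v : Fin (nV G)) (g : ℕ → Bool) →
               (∀ j → lookup (edge G j) v ≡ g (toℕ j)) → degree G v ≡ count g (nE G)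
degree-count G v g edge≗g =
  filter-count (nE G) (λ j → j) (λ j → v ∈? edge G j) g (λ j → trans (∈?-does v (edge G j)) (edge≗g j))

cycleEdge-lookup : ∀ k s {n} .{{_ : NonZero n}} e (v : Fin n) → e * (k ∸ s) ≤ n →
                   lookup (cycleEdge k s n e) v ≡ ⌊ (n ∸ e * (k ∸ s) + toℕ v) % n <? k ⌋
cycleEdge-lookup k s {suc n′} e v e≤n =
  trans (lookup∘tabulate (λ w → any (λ i → ⌊ (e * (k ∸ s) + i) % suc n′ ≟ toℕ w ⌋) (upTo k)) v)
        (window-member k (e * (k ∸ s)) (toℕ v) e≤n (toℕ<n v))

block-mod : ∀ y m D {b} .{{_ : NonZero m}} .{{_ : NonZero D}} .{{_ : NonZero (m * D)}} → b < D →
            (y * D + b) % (m * D) ≡ y % m * D + b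
block-mod y m D b<D =
  trans ([m*n+o]%[p*n]≡[m*n]%[p*n]+o y m b<D) (cong (_+ _) (sym (m%n*o≡m*o%[n*o] y m D)))

block-< : ∀ y q {D b} → b < D → ⌊ y * D + b <? q * D ⌋ ≡ ⌊ y <? q ⌋
block-< y q {D} {b} b<D = ⌊⌋-⇔ (y * D + b <? q * D) (y <? q) (mk⇔ cancel scale)
  where
  cancel : y * D + b < q * D → y < q
  cancel lt = *-cancelʳ-< D y q (≤-<-trans (m≤m+n (y * D) b) lt)
  scale : y < q → y * D + b < q * D
  scale y<q = <-≤-trans (+-monoʳ-< (y * D) b<D)
                        (subst (_≤ q * D) (+-comm D (y * D)) (*-monoˡ-≤ D y<q))

other-residue : ∀ {D} → 1 < D → ∀ t → Σ ℕ λ w → w < D × w ≢ t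
other-residue 1<D zero    = 1 , 1<D , λ ()
other-residue 1<D (suc t) = 0 , <-trans z<s 1<D , λ ()

-- For 0 < r some t ≤ r makes q + [t < r] odd: t = 0 if q is even, t = r if q is odd.
odd-residue-count : ∀ q r → 0 < r → Σ ℕ λ t → t ≤ r × Odd (q + bit ⌊ t <? r ⌋)
odd-residue-count q r 0<r with q % 2 in q%2 | m%n<n q 2
... | 0 | _ = 0 , z≤n , subst (λ b → Odd (q + bit b)) (sym (⌊⌋-true (0 <? r) 0<r)) q+1-odd
  where
  q+1-odd : Odd (q + 1)
  q+1-odd = trans (%-distribˡ-+ q 1 2) (cong (λ z → (z + 1) % 2) q%2)
... | 1 | _ = r , ≤-refl , subst (λ b → Odd (q + bit b)) (sym (⌊⌋-false (r <? r) (<-irrefl refl)))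
                              (subst Odd (sym (+-identityʳ q)) q%2)
... | suc (suc _) | s<s (s<s ())

module SCycle (k s m : ℕ) .{{_ : NonZero m}} .{{_ : NonZero (k ∸ s)}} (k<n : k < m * (k ∸ s)) where

  D : ℕ
  D = k ∸ s

  n : ℕ
  n = m * D

  instance
    n≢0 : NonZero n
    n≢0 = m*n≢0 m D

  G : Hypergraph
  G = sCycle k s m

  offset : ∀ j → n ∸ j * D ≡ (m ∸ j) * D
  offset j = sym (*-distribʳ-∸ D m j)

  edge-lookup : (j : Fin m) (v : Fin n) → lookup (edge G j) v ≡ ⌊ (n ∸ toℕ j * D + toℕ v) % n <? k ⌋
  edge-lookup j v = cycleEdge-lookup k s (toℕ j) v (*-monoˡ-≤ D (<⇒≤ (toℕ<n j)))

  class : ℕ → Subset n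
  class t = tabulate (λ v → ⌊ toℕ v % D ≟ t ⌋)

  -- Writing k = q·D + r, every edge meets the class of t < D in q + [t < r]
  -- vertices: rotating the edge to start at 0 preserves residues mod D.
  edge-∩-class : ∀ q r t → k ≡ q * D + r → r ≤ D → t < D → (j : Fin m) →
                 ∣ edge G j ∩ class t ∣ ≡ q + bit ⌊ t <? r ⌋
  edge-∩-class q r t k≡qD+r r≤D t<D j = begin
    ∣ edge G j ∩ class t ∣
      ≡⟨ ∣∣-count (edge G j ∩ class t) (λ x → F ((c + x) % n)) lookup-∩ ⟩
    count (λ x → F ((c + x) % n)) n           ≡⟨ count-rotate n c F (m∸n≤m n (toℕ j * D)) ⟩
    count F n                                 ≡⟨ count-prefix (λ y → ⌊ y % D ≟ t ⌋) (<⇒≤ k<n) ⟩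
    count (λ y → ⌊ y % D ≟ t ⌋) k             ≡⟨ cong (count (λ y → ⌊ y % D ≟ t ⌋)) k≡qD+r ⟩
    count (λ y → ⌊ y % D ≟ t ⌋) (q * D + r)   ≡⟨ count-residue D t q r t<D r≤D ⟩
    q + bit ⌊ t <? r ⌋                        ∎
    where
    open ≡-Reasoning
    c : ℕ
    c = n ∸ toℕ j * D
    F : ℕ → Bool
    F y = ⌊ y <? k ⌋ ∧ ⌊ y % D ≟ t ⌋
    -- D divides both n and c, so the rotation x ↦ (c + x) mod n keeps x mod D.
    residue-shift : ∀ x → (c + x) % n % D ≡ x % D
    residue-shift x = begin
      (c + x) % n % D              ≡⟨ m∣n⇒o%n%m≡o%m D n (c + x) (n∣m*n m) ⟩
      (c + x) % D                  ≡⟨ cong (λ z → (z + x) % D) (offset (toℕ j)) ⟩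
      ((m ∸ toℕ j) * D + x) % D    ≡⟨ %-remove-+ˡ x (n∣m*n (m ∸ toℕ j)) ⟩
      x % D                        ∎
    lookup-∩ : ∀ v → lookup (edge G j ∩ class t) v ≡ F ((c + toℕ v) % n)
    lookup-∩ v = trans (lookup-zipWith _∧_ v (edge G j) (class t))
      (cong₂ _∧_ (edge-lookup j v)
        (trans (lookup∘tabulate (λ w → ⌊ toℕ w % D ≟ t ⌋) v)
               (cong (λ z → ⌊ z ≟ t ⌋) (sym (residue-shift (toℕ v))))))

  distance-from-reversed-edge : ∀ x a b → x < m →
    n ∸ (m ∸ suc x) * D + (b + a * D) ≡ (suc a + x) * D + b
  distance-from-reversed-edge x a b x<m = begin
    n ∸ (m ∸ suc x) * D + (b + a * D)        ≡⟨ cong (λ z → n ∸ z + (b + a * D)) (sym (offset (suc x))) ⟩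
    n ∸ (n ∸ suc x * D) + (b + a * D)        ≡⟨ cong (_+ (b + a * D)) (m∸[m∸n]≡n (*-monoˡ-≤ D x<m)) ⟩
    suc x * D + (b + a * D)                  ≡⟨ reorder x a b D ⟩
    (suc a + x) * D + b                      ∎
    where
    open ≡-Reasoning
    reorder : ∀ x a b D → suc x * D + (b + a * D) ≡ (suc a + x) * D + b
    reorder = solve-∀

  -- If k = q·D, every vertex a·D + b lies in exactly q edges: reversing and
  -- rotating the edge indices turns the incidences into the blocks below q.
  degree-divisible : ∀ q → k ≡ q * D → (v : Fin n) → degree G v ≡ q
  degree-divisible q k≡qD v = begin
    degree G v                                  ≡⟨ degree-count G v covers (λ j → edge-lookup j v) ⟩
    count covers m                              ≡⟨ sym (count-reverse m covers) ⟩
    count (λ x → covers (m ∸ suc x)) m          ≡⟨ count-cong m reversed-covers ⟩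
    count (λ x → below-q ((suc a + x) % m)) m   ≡⟨ count-rotate m (suc a) below-q a<m ⟩
    count below-q m                             ≡⟨ count-below (<⇒≤ q<m) ⟩
    q                                           ∎
    where
    open ≡-Reasoning
    covers : ℕ → Bool
    covers j = ⌊ (n ∸ j * D + toℕ v) % n <? k ⌋
    below-q : ℕ → Bool
    below-q y = ⌊ y <? q ⌋
    a b : ℕ
    a = toℕ v / D
    b = toℕ v % D
    a<m : a < m
    a<m = m<n*o⇒m/o<n (toℕ<n v)
    q<m : q < m
    q<m = *-cancelʳ-< D q m (subst (_< n) k≡qD k<n)
    reversed-covers : ∀ x → x < m → covers (m ∸ suc x) ≡ below-q ((suc a + x) % m)
    reversed-covers x x<m = begin
      ⌊ (n ∸ (m ∸ suc x) * D + toℕ v) % n <? k ⌋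
        ≡⟨ cong (λ z → ⌊ (n ∸ (m ∸ suc x) * D + z) % n <? k ⌋) (m≡m%n+[m/n]*n (toℕ v) D) ⟩
      ⌊ (n ∸ (m ∸ suc x) * D + (b + a * D)) % n <? k ⌋
        ≡⟨ cong (λ z → ⌊ z % n <? k ⌋) (distance-from-reversed-edge x a b x<m) ⟩
      ⌊ ((suc a + x) * D + b) % n <? k ⌋
        ≡⟨ cong₂ (λ z w → ⌊ z <? w ⌋) (block-mod (suc a + x) m D (m%n<n (toℕ v) D)) k≡qD ⟩
      ⌊ (suc a + x) % m * D + b <? q * D ⌋
        ≡⟨ block-< ((suc a + x) % m) q (m%n<n (toℕ v) D) ⟩
      ⌊ (suc a + x) % m <? q ⌋
        ∎

  regular-if-divisible : D ∣ k → Regular G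
  regular-if-divisible (divides q k≡qD) u v =
    trans (degree-divisible q k≡qD u) (sym (degree-divisible q k≡qD v))

  vertex : ∀ w → w < D → Fin n
  vertex w w<D = fromℕ< (<-≤-trans w<D (m≤n*m D m))

  vertex-residue : ∀ w (w<D : w < D) → toℕ (vertex w w<D) % D ≡ w
  vertex-residue w w<D = trans (cong (_% D) (toℕ-fromℕ< _)) (m<n⇒m%n≡m w<D)

  class-proper : 1 < D → ∀ {t} → t < D → Nonempty (class t) × Nonempty (∁ (class t))
  class-proper 1<D {t} t<D with other-residue 1<D t
  ... | w , w<D , w≢t = (vertex t t<D , in-class) , (vertex w w<D , out-of-class)
    where
    in-class : vertex t t<D ∈ class t
    in-class = lookup⇒[]= (vertex t t<D) (class t)
      (trans (lookup∘tabulate (λ x → ⌊ toℕ x % D ≟ t ⌋) (vertex t t<D))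
             (⌊⌋-true (_ ≟ t) (vertex-residue t t<D)))
    out-of-class : vertex w w<D ∈ ∁ (class t)
    out-of-class = lookup⇒[]= (vertex w w<D) (∁ (class t))
      (trans (lookup-map (vertex w w<D) not (class t))
        (cong not (trans (lookup∘tabulate (λ x → ⌊ toℕ x % D ≟ t ⌋) (vertex w w<D))
                         (⌊⌋-false (_ ≟ t) (λ eq → w≢t (trans (sym (vertex-residue w w<D)) eq))))))

  odd-bipartite-if-not-divisible : k % D ≢ 0 → OddBipartite G
  odd-bipartite-if-not-divisible r≢0 with odd-residue-count (k / D) (k % D) (n≢0⇒n>0 r≢0)
  ... | t , t≤r , odd = inj₂ (class t , proj₁ proper , proj₂ proper , odd-meets)
    where
    t<D : t < D
    t<D = ≤-<-trans t≤r (m%n<n k D)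
    proper : Nonempty (class t) × Nonempty (∁ (class t))
    proper = class-proper (<-≤-trans (s<s (n≢0⇒n>0 r≢0)) (m%n<n k D)) t<D
    k≡qD+r : k ≡ k / D * D + k % D
    k≡qD+r = trans (m≡m%n+[m/n]*n k D) (+-comm (k % D) _)
    odd-meets : ∀ j → Odd ∣ edge G j ∩ class t ∣
    odd-meets j = subst Odd (sym (edge-∩-class (k / D) (k % D) t k≡qD+r (<⇒≤ (m%n<n k D)) t<D j)) odd

  non-regular⇒odd-bipartite : ¬ Regular G → OddBipartite G
  non-regular⇒odd-bipartite ¬regular with k % D ≟ 0
  ... | yes r≡0 = ⊥-elim (¬regular (regular-if-divisible (m%n≡0⇒n∣m k D r≡0)))
  ... | no  r≢0 = odd-bipartite-if-not-divisible r≢0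

-- The hypothesis n ≥ 2k - s = k + (k - s) makes every edge a proper window.
k<2k∸s : ∀ {k s} → s < k → k < (k + k) ∸ s
k<2k∸s {k} {s} s<k =
  subst (k <_) (sym (+-∸-assoc k (<⇒≤ s<k))) (m<m+n k (m<n⇒0<n∸m s<k))

proposition4p2 : (k s m : ℕ) → k % 2 ≡ 0 → 4 ≤ k → 1 ≤ s → s < k → 1 ≤ m →
    (k + k) ∸ s ≤ m * (k ∸ s) →
    ¬ Regular (sCycle k s m) → OddBipartite (sCycle k s m)
proposition4p2 k s m@(suc _) _ _ _ s<k _ 2k∸s≤n = non-regular⇒odd-bipartite
  where
  instance
    D≢0 : NonZero (k ∸ s)
    D≢0 = >-nonZero (m<n⇒0<n∸m s<k)
  open SCycle k s m (<-≤-trans (k<2k∸s s<k) 2k∸s≤n)
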